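{- Let $G$ be a finite simple graph in which no vertex is isolatable. If $I$ is any maximum independent set in $G$ and $x$ is any vertex of $I$, then the subgraph $G-N[I-\{x\}]$ is a clique of order at least two.
   Context: For a set $S$ of vertices, $N[S]$ denotes the closed neighborhood of $S$ (the vertices of $S$ together with all vertices adjacent to some vertex of $S$), and $G-N[S]$ is the subgraph obtained by deleting these vertices. A vertex $x$ of $G$ is isolatable if there is an independent set $M$ of $G$ such that $G-N[M]$ consists of the single vertex $x$. -}

module Defs where

open import Data.Nat using (ℕ; _≤_)
open import Data.Fin using (Fin)
open import Data.Fin.Subset using (Subset; _∈_; _∉_; ∣_∣; _─_; ⁅_⁆)
open import Data.Product using (Σ; ∃; ∃-syntax; _×_; _,_)
open import Data.Sum using (_⊎_)
open import Relation.Nullary using (¬_)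
open import Relation.Binary using (Decidable)
open import Relation.Binary.PropositionalEquality using (_≡_)
open import Function.Bundles using (_⇔_)

record Graph (n : ℕ) : Set₁ where
  field
    Adj   : Fin n → Fin n → Set
    adj?  : Decidable Adj
    sym   : ∀ {u v} → Adj u v → Adj v u
    irrefl : ∀ {u} → ¬ Adj u u

module _ {n : ℕ} (G : Graph n) where
  open Graph G

  Independent : Subset n → Set
  Independent S = ∀ u v → u ∈ S → v ∈ S → ¬ Adj u v

  MaximumIndependent : Subset n → Set
  MaximumIndependent I = Independent I × (∀ J → Independent J → ∣ J ∣ ≤ ∣ I ∣)

  InClosedNbhd : Subset n → Fin n → Set
  InClosedNbhd S v = v ∈ S ⊎ (∃[ u ] (u ∈ S × Adj u v))

  InRemainder : Subset n → Fin n → Set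
  InRemainder S v = ¬ InClosedNbhd S v

  Isolatable : Fin n → Set
  Isolatable x = ∃[ M ] (Independent M × (∀ v → InRemainder M v ⇔ (v ≡ x)))

  CliqueOfOrderAtLeastTwo : (Fin n → Set) → Set
  CliqueOfOrderAtLeastTwo P =
    (∀ u v → P u → P v → ¬ u ≡ v → Adj u v) ×
    (∃[ u ] ∃[ v ] (P u × P v × ¬ u ≡ v))

module Submission where

-- Proof idea.  Let I be a maximum independent set, x ∈ I and S = I - x.
-- S is independent and x lies in G - N[S] (x has no neighbour in I).
--
-- If u ≠ v were non-adjacent vertices of G - N[S], then
--   S ∪ {u} ∪ {v} would be independent of size |S| + 2 > |I|, since
--   removing one vertex lowers the size of a set by at most one.
--   This is the general fact `remainder-clique`: whenever every
--   independent set has size at most |S| + 1, G - N[S] is a clique.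
-- * Order ≥ 2.  G - N[S] contains x; if it contained nothing else, S
--   would witness that x is isolatable (`second-remainder-vertex`).

open import Defs
open import Data.Nat using (ℕ; suc; _≤_; _<_; s≤s)
open import Data.Nat.Properties using (≤-refl; ≤-trans; n≤1+n; <-≤-trans; 1+n≰n)
open import Data.Fin using (Fin; zero; suc)
open import Data.Fin.Properties using (any?) renaming (_≟_ to _≟ᶠ_)
open import Data.Fin.Subset
  using (Subset; _∈_; _∉_; _⊆_; _─_; _-_; _∪_; ⁅_⁆; ∣_∣; inside; outside)
open import Data.Fin.Subset.Properties
  using (_∈?_; x∈⁅x⁆; x∈⁅y⁆⇒x≡y; x∈p∪q⁻; p⊆p∪q; q⊆p∪q; p─q⊆p; ∪-identityʳ;
         x∈p∧x≢y⇒x∈p-y; p⊆q⇒∣p∣≤∣q∣; p⊂q⇒∣p∣<∣q∣)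
open import Data.Vec using (_∷_)
open import Data.Vec.Base using (here; there)
open import Data.Product using (∃-syntax; _×_; _,_)
open import Data.Sum using (inj₁; inj₂)
open import Data.Empty using (⊥-elim)
open import Relation.Nullary using (¬_; Dec; yes; no)
open import Relation.Nullary.Decidable using (_⊎-dec_; _×-dec_; ¬?)
open import Relation.Binary.PropositionalEquality using (_≡_; refl; sym; subst)
open import Function.Bundles using (mk⇔)

x∈p─q⇒x∉q : ∀ {n} {x : Fin n} (p q : Subset n) → x ∈ p ─ q → x ∉ q
x∈p─q⇒x∉q (_ ∷ p) (outside ∷ q) (there x∈) (there x∈q) = x∈p─q⇒x∉q p q x∈ x∈q
x∈p─q⇒x∉q (_ ∷ p) (inside ∷ q)  (there x∈) (there x∈q) = x∈p─q⇒x∉q p q x∈ x∈q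
x∈p─q⇒x∉q (inside ∷ p) (outside ∷ q) here ()

∣p∪⁅x⁆∣≤1+∣p∣ : ∀ {n} (p : Subset n) (x : Fin n) → ∣ p ∪ ⁅ x ⁆ ∣ ≤ suc ∣ p ∣
∣p∪⁅x⁆∣≤1+∣p∣ (inside ∷ p)  zero    rewrite ∪-identityʳ p = n≤1+n (suc ∣ p ∣)
∣p∪⁅x⁆∣≤1+∣p∣ (outside ∷ p) zero    rewrite ∪-identityʳ p = ≤-refl
∣p∪⁅x⁆∣≤1+∣p∣ (inside ∷ p)  (suc x) = s≤s (∣p∪⁅x⁆∣≤1+∣p∣ p x)
∣p∪⁅x⁆∣≤1+∣p∣ (outside ∷ p) (suc x) = ∣p∪⁅x⁆∣≤1+∣p∣ p x

∣p∣≤1+∣p-x∣ : ∀ {n} (p : Subset n) (x : Fin n) → ∣ p ∣ ≤ suc ∣ p - x ∣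
∣p∣≤1+∣p-x∣ p x = ≤-trans (p⊆q⇒∣p∣≤∣q∣ p⊆p-x∪x) (∣p∪⁅x⁆∣≤1+∣p∣ (p - x) x)
  where
  p⊆p-x∪x : p ⊆ (p - x) ∪ ⁅ x ⁆
  p⊆p-x∪x {y} y∈p with y ≟ᶠ x
  ... | yes refl = q⊆p∪q (p - x) ⁅ x ⁆ (x∈⁅x⁆ x)
  ... | no y≢x   = p⊆p∪q ⁅ x ⁆ (x∈p∧x≢y⇒x∈p-y y∈p y≢x)

module _ {n : ℕ} (G : Graph n) where
  open Graph G using (Adj; adj?; irrefl) renaming (sym to adj-sym)

  remainder? : (S : Subset n) (v : Fin n) → Dec (InRemainder G S v)
  remainder? S v = ¬? ((v ∈? S) ⊎-dec any? (λ u → (u ∈? S) ×-dec adj? u v))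

  independent-⊆ : ∀ {S T} → S ⊆ T → Independent G T → Independent G S
  independent-⊆ S⊆T indT u v u∈S v∈S = indT u v (S⊆T u∈S) (S⊆T v∈S)

  extend-independent : ∀ {S v} → Independent G S → InRemainder G S v →
                       Independent G (S ∪ ⁅ v ⁆)
  extend-independent {S} {v} indS v-rem a b a∈ b∈ a~b
    with x∈p∪q⁻ S ⁅ v ⁆ a∈ | x∈p∪q⁻ S ⁅ v ⁆ b∈
  ... | inj₁ a∈S | inj₁ b∈S = indS a b a∈S b∈S a~b
  ... | inj₁ a∈S | inj₂ b∈v with x∈⁅y⁆⇒x≡y v b∈v
  ...   | refl = v-rem (inj₂ (a , a∈S , a~b))
  extend-independent {S} {v} indS v-rem a b a∈ b∈ a~b
      | inj₂ a∈v | inj₁ b∈S with x∈⁅y⁆⇒x≡y v a∈v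
  ...   | refl = v-rem (inj₂ (b , b∈S , adj-sym a~b))
  extend-independent {S} {v} indS v-rem a b a∈ b∈ a~b
      | inj₂ a∈v | inj₂ b∈v with x∈⁅y⁆⇒x≡y v a∈v | x∈⁅y⁆⇒x≡y v b∈v
  ...   | refl | refl = irrefl a~b

  remainder-after-extend : ∀ {S u v} → InRemainder G S u → ¬ u ≡ v →
                           ¬ Adj v u → InRemainder G (S ∪ ⁅ v ⁆) u
  remainder-after-extend {S} {u} {v} u-rem u≢v v≁u (inj₁ u∈)
    with x∈p∪q⁻ S ⁅ v ⁆ u∈
  ... | inj₁ u∈S = u-rem (inj₁ u∈S)
  ... | inj₂ u∈v = u≢v (x∈⁅y⁆⇒x≡y v u∈v)
  remainder-after-extend {S} {u} {v} u-rem u≢v v≁u (inj₂ (w , w∈ , w~u))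
    with x∈p∪q⁻ S ⁅ v ⁆ w∈
  ... | inj₁ w∈S = u-rem (inj₂ (w , w∈S , w~u))
  ... | inj₂ w∈v = v≁u (subst (λ w → Adj w u) (x∈⁅y⁆⇒x≡y v w∈v) w~u)

  remainder-grows : ∀ {S v} → InRemainder G S v → ∣ S ∣ < ∣ S ∪ ⁅ v ⁆ ∣
  remainder-grows {S} {v} v-rem =
    p⊂q⇒∣p∣<∣q∣ (p⊆p∪q ⁅ v ⁆ , v , q⊆p∪q S ⁅ v ⁆ (x∈⁅x⁆ v) , λ v∈S → v-rem (inj₁ v∈S))

  -- If S is independent and no independent set has more than |S| + 1
  -- vertices, then G - N[S] is a clique: two non-adjacent vertices u, v
  -- of it would extend S to an independent set of size |S| + 2.
  remainder-clique : ∀ {S} → Independent G S →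
                     (∀ J → Independent G J → ∣ J ∣ ≤ suc ∣ S ∣) →
                     ∀ u v → InRemainder G S u → InRemainder G S v →
                     ¬ u ≡ v → Adj u v
  remainder-clique {S} indS bound u v u-rem v-rem u≢v with adj? u v
  ... | yes u~v = u~v
  ... | no u≁v = ⊥-elim (1+n≰n (≤-trans too-big (bound J indJ)))
    where
    v-rem′ : InRemainder G (S ∪ ⁅ u ⁆) v
    v-rem′ = remainder-after-extend v-rem (λ v≡u → u≢v (sym v≡u)) u≁v

    J : Subset n
    J = (S ∪ ⁅ u ⁆) ∪ ⁅ v ⁆

    indJ : Independent G J
    indJ = extend-independent (extend-independent indS u-rem) v-rem′

    too-big : suc (suc ∣ S ∣) ≤ ∣ J ∣
    too-big = <-≤-trans (s≤s (remainder-grows u-rem)) (remainder-grows v-rem′)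

  second-remainder-vertex : ∀ {S x} → ¬ Isolatable G x → Independent G S →
                            InRemainder G S x →
                            ∃[ w ] (InRemainder G S w × ¬ w ≡ x)
  second-remainder-vertex {S} {x} not-iso indS x-rem
    with any? (λ w → remainder? S w ×-dec ¬? (w ≟ᶠ x))
  ... | yes found = found
  ... | no none = ⊥-elim (not-iso (S , indS , λ v → mk⇔ (only-x v) (λ { refl → x-rem })))
    where
    only-x : ∀ v → InRemainder G S v → v ≡ x
    only-x v v-rem with v ≟ᶠ x
    ... | yes v≡x = v≡x
    ... | no v≢x = ⊥-elim (none (v , v-rem , v≢x))

  removed-vertex-in-remainder : ∀ {I x} → Independent G I → x ∈ I →
                                InRemainder G (I - x) x
  removed-vertex-in-remainder {I} {x} indI x∈I (inj₁ x∈I-x) =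
    x∈p─q⇒x∉q I ⁅ x ⁆ x∈I-x (x∈⁅x⁆ x)
  removed-vertex-in-remainder {I} {x} indI x∈I (inj₂ (u , u∈I-x , u~x)) =
    indI u x (p─q⊆p I ⁅ x ⁆ u∈I-x) x∈I u~x

lemma3 : (n : ℕ) (G : Graph n) → (∀ x → ¬ Isolatable G x) →
    (I : Subset n) → MaximumIndependent G I → (x : Fin n) → x ∈ I →
    CliqueOfOrderAtLeastTwo G (InRemainder G (I ─ ⁅ x ⁆))
lemma3 n G no-isolatable I (indI , maxI) x x∈I =
  let (w , w-rem , w≢x) = second-remainder-vertex G (no-isolatable x) indS x-rem
  in remainder-clique G indS bound , x , w , x-rem , w-rem , λ x≡w → w≢x (sym x≡w)
  where
  indS : Independent G (I - x)
  indS = independent-⊆ G (p─q⊆p I ⁅ x ⁆) indI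

  bound : ∀ J → Independent G J → ∣ J ∣ ≤ suc ∣ I - x ∣
  bound J indJ = ≤-trans (maxI J indJ) (∣p∣≤1+∣p-x∣ I x)

  x-rem : InRemainder G (I - x) x
  x-rem = removed-vertex-in-remainder G indI x∈I
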